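{- For all integers $n,k\ge0$, $I_n\big(((x-1)(y-1))^k\big)=1$, where for a polynomial $p(x,y)=\sum_{i,j\ge0}a_{i,j}x^iy^j$ one defines $$I_n(p)=\sum_{i=0}^n\sum_{j=0}^{n-i}(-1)^j\binom{n-i}{j}a_{i,j}.$$ -}

module Defs where

open import Data.Nat using (ℕ; zero; suc; _∸_)
open import Data.Nat.Combinatorics using (_C_)
open import Data.Integer using (ℤ; +_; -_; _+_; _*_; 0ℤ; 1ℤ; -1ℤ)
open import Data.List using (List; []; _∷_)

-- Univariate polynomials over ℤ in y: list of coefficients, lowest degree first.
PolyY : Set
PolyY = List ℤ

-- Bivariate polynomials in x,y over ℤ: list (indexed by the power i of x)
-- of univariate polynomials in y.  a_{i,j} = coefficient of x^i y^j.
Poly2 : Set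
Poly2 = List PolyY

coeffY : PolyY → ℕ → ℤ
coeffY []       _       = 0ℤ
coeffY (a ∷ _)  zero    = a
coeffY (_ ∷ as) (suc j) = coeffY as j

coeff : Poly2 → ℕ → ℕ → ℤ
coeff []       _       _ = 0ℤ
coeff (p ∷ _)  zero    j = coeffY p j
coeff (_ ∷ ps) (suc i) j = coeff ps i j

addY : PolyY → PolyY → PolyY
addY []       q        = q
addY p        []       = p
addY (a ∷ p)  (b ∷ q)  = (a + b) ∷ addY p q

scaleY : ℤ → PolyY → PolyY
scaleY c []      = []
scaleY c (a ∷ p) = (c * a) ∷ scaleY c p

mulY : PolyY → PolyY → PolyY
mulY []      q = []
mulY (a ∷ p) q = addY (scaleY a q) (0ℤ ∷ mulY p q)

add2 : Poly2 → Poly2 → Poly2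
add2 []      q       = q
add2 p       []      = p
add2 (a ∷ p) (b ∷ q) = addY a b ∷ add2 p q

scale2 : PolyY → Poly2 → Poly2
scale2 c []      = []
scale2 c (a ∷ p) = mulY c a ∷ scale2 c p

mul2 : Poly2 → Poly2 → Poly2
mul2 []      q = []
mul2 (a ∷ p) q = add2 (scale2 a q) ([] ∷ mul2 p q)

one2 : Poly2
one2 = (1ℤ ∷ []) ∷ []

pow2 : Poly2 → ℕ → Poly2
pow2 p zero    = one2
pow2 p (suc k) = mul2 p (pow2 p k)

xMinus1 : Poly2
xMinus1 = (-1ℤ ∷ []) ∷ (1ℤ ∷ []) ∷ []

yMinus1 : Poly2
yMinus1 = (-1ℤ ∷ 1ℤ ∷ []) ∷ []

sgn : ℕ → ℤ
sgn zero    = 1ℤ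
sgn (suc j) = - sgn j

sumTo : ℕ → (ℕ → ℤ) → ℤ
sumTo zero    f = f zero
sumTo (suc n) f = sumTo n f + f (suc n)

I : ℕ → Poly2 → ℤ
I n p = sumTo n (λ i → sumTo (n ∸ i) (λ j → sgn j * (+ ((n ∸ i) C j)) * coeff p i j))

-- Write β m g = Σ_{j ≤ m} (-1)^j C(m,j) g j (binomialTransform), so that
-- I_n(p) = Σ_{i ≤ n} β (n - i) p_i, where p_i is the coefficient sequence of x^i.
-- Pascal's rule gives β (m + 1) g = β m g - β m (g ∘ suc), hence
-- β m ((y - 1) h) = - Σ_{k ≤ m} β k h.
-- After also multiplying by x - 1, I_n((x-1)(y-1)p) becomes a telescoping sum of
-- these partial sums that collapses to I_n(p); and I_n(1) = 1.
-- (Equivalently, I_n(p) is the coefficient of t^n in p(t, -t/(1-t)) / (1-t), and this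
-- substitution sends (x-1)(y-1) to 1.)
module Submission where

open import Defs
open import Data.Nat using (ℕ; zero; suc; _∸_)
open import Data.Nat.Combinatorics using (_C_; k>n⇒nCk≡0; nCk+nC[k+1]≡[n+1]C[k+1])
open import Data.Nat.Properties using (n<1+n)
open import Data.Integer using (ℤ; +_; -_; _+_; _-_; _*_; 0ℤ; 1ℤ; -1ℤ)
open import Data.Integer.Properties
  using (pos-+; +-assoc; +-identityˡ; +-identityʳ; *-identityˡ; *-zeroʳ; neg-distrib-+)
open import Data.Integer.Tactic.RingSolver using (solve-∀)
open import Data.List using ([]; _∷_)
open import Function using (_∘_)
open import Relation.Binary.PropositionalEquality
  using (_≡_; refl; sym; trans; cong; cong₂; module ≡-Reasoning)
open ≡-Reasoning

sumTo-cong : ∀ n {f g : ℕ → ℤ} → (∀ i → f i ≡ g i) → sumTo n f ≡ sumTo n g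
sumTo-cong zero    f≗g = f≗g 0
sumTo-cong (suc n) f≗g = cong₂ _+_ (sumTo-cong n f≗g) (f≗g (suc n))

sumTo-zero : ∀ n {f : ℕ → ℤ} → (∀ i → f i ≡ 0ℤ) → sumTo n f ≡ 0ℤ
sumTo-zero zero    f≗0 = f≗0 0
sumTo-zero (suc n) f≗0 = cong₂ _+_ (sumTo-zero n f≗0) (f≗0 (suc n))

sumTo-shift : ∀ n (f : ℕ → ℤ) → sumTo (suc n) f ≡ f 0 + sumTo n (f ∘ suc)
sumTo-shift zero    f = refl
sumTo-shift (suc n) f = begin
  sumTo (suc n) f + f (suc (suc n))             ≡⟨ cong (_+ f (suc (suc n))) (sumTo-shift n f) ⟩
  (f 0 + sumTo n (f ∘ suc)) + f (suc (suc n))  ≡⟨ +-assoc (f 0) _ _ ⟩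
  f 0 + sumTo (suc n) (f ∘ suc)                 ∎

sumTo-sub : ∀ n (f g : ℕ → ℤ) → sumTo n (λ i → f i - g i) ≡ sumTo n f - sumTo n g
sumTo-sub zero    f g = refl
sumTo-sub (suc n) f g =
  trans (cong (_+ (f (suc n) - g (suc n))) (sumTo-sub n f g))
        (interchange (sumTo n f) (sumTo n g) (f (suc n)) (g (suc n)))
  where
  interchange : ∀ a b c d → (a - b) + (c - d) ≡ (a + c) - (b + d)
  interchange = solve-∀

-- Multiplication by the variable, on coefficient sequences with zero coefficient z.
shift : {A : Set} → A → (ℕ → A) → ℕ → A
shift z f zero    = z
shift z f (suc j) = f j

shift-const : ∀ {A : Set} (z : A) j → shift z (λ _ → z) j ≡ z
shift-const z zero    = refl
shift-const z (suc j) = refl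

zeroRow : ℕ → ℤ
zeroRow _ = 0ℤ

mulYMinus1 : (ℕ → ℤ) → ℕ → ℤ
mulYMinus1 h j = shift 0ℤ h j - h j

mulXMinus1 : (ℕ → ℕ → ℤ) → ℕ → ℕ → ℤ
mulXMinus1 a i j = shift zeroRow a i j - a i j

binomialTransform : ℕ → (ℕ → ℤ) → ℤ
binomialTransform m g = sumTo m (λ j → sgn j * + (m C j) * g j)

binomialTransform-cong : ∀ m {f g : ℕ → ℤ} → (∀ j → f j ≡ g j) →
                         binomialTransform m f ≡ binomialTransform m g
binomialTransform-cong m f≗g = sumTo-cong m (λ j → cong (sgn j * + (m C j) *_) (f≗g j))

binomialTransform-zero : ∀ g → binomialTransform 0 g ≡ g 0
binomialTransform-zero g = *-identityˡ (g 0)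

binomialTransform-suc : ∀ m g → binomialTransform (suc m) g ≡
                        binomialTransform m g - binomialTransform m (g ∘ suc)
binomialTransform-suc m g = begin
  sumTo (suc m) (term (suc m))
    ≡⟨ sumTo-shift m (term (suc m)) ⟩
  term m 0 + sumTo m (term (suc m) ∘ suc)
    ≡⟨ cong (_+_ (term m 0)) (trans (sumTo-cong m pascal) (sumTo-sub m _ _)) ⟩
  term m 0 + (sumTo m (term m ∘ suc) - binomialTransform m (g ∘ suc))
    ≡⟨ sym (+-assoc (term m 0) _ _) ⟩
  (term m 0 + sumTo m (term m ∘ suc)) - binomialTransform m (g ∘ suc)
    ≡⟨ cong (_- binomialTransform m (g ∘ suc)) (sym (sumTo-shift m (term m))) ⟩
  (binomialTransform m g + term m (suc m)) - binomialTransform m (g ∘ suc)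
    ≡⟨ cong (λ t → (binomialTransform m g + t) - binomialTransform m (g ∘ suc)) top ⟩
  (binomialTransform m g + 0ℤ) - binomialTransform m (g ∘ suc)
    ≡⟨ cong (_- binomialTransform m (g ∘ suc)) (+-identityʳ (binomialTransform m g)) ⟩
  binomialTransform m g - binomialTransform m (g ∘ suc) ∎
  where
  term : ℕ → ℕ → ℤ
  term k j = sgn j * + (k C j) * g j

  pascal : ∀ j → term (suc m) (suc j) ≡ term m (suc j) - sgn j * + (m C j) * g (suc j)
  pascal j = trans
    (cong (λ c → (- sgn j) * c * g (suc j))
          (trans (cong +_ (sym (nCk+nC[k+1]≡[n+1]C[k+1] m j))) (pos-+ (m C j) (m C suc j))))
    (split (sgn j) _ _ _)
    where
    split : ∀ s a b x → (- s) * (a + b) * x ≡ (- s) * b * x - s * a * x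
    split = solve-∀

  top : term m (suc m) ≡ 0ℤ
  top = trans (cong (λ c → sgn (suc m) * + c * g (suc m)) (k>n⇒nCk≡0 (n<1+n m)))
              (vanish (sgn (suc m)) (g (suc m)))
    where
    vanish : ∀ s x → s * 0ℤ * x ≡ 0ℤ
    vanish = solve-∀

binomialTransform-sub : ∀ m (f g : ℕ → ℤ) →
  binomialTransform m (λ j → f j - g j) ≡ binomialTransform m f - binomialTransform m g
binomialTransform-sub m f g =
  trans (sumTo-cong m (λ j → distrib (sgn j * + (m C j)) (f j) (g j))) (sumTo-sub m _ _)
  where
  distrib : ∀ c x y → c * (x - y) ≡ c * x - c * y
  distrib = solve-∀

binomialTransform-zeroRow : ∀ m → binomialTransform m zeroRow ≡ 0ℤ
binomialTransform-zeroRow m = sumTo-zero m (λ j → *-zeroʳ (sgn j * + (m C j)))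

binomialTransform-unit : ∀ m → binomialTransform m (coeffY (1ℤ ∷ [])) ≡ 1ℤ
binomialTransform-unit zero    = refl
binomialTransform-unit (suc m) =
  trans (binomialTransform-suc m (coeffY (1ℤ ∷ [])))
        (cong₂ _-_ (binomialTransform-unit m) (binomialTransform-zeroRow m))

partialSums : (ℕ → (ℕ → ℤ) → ℤ) → ℕ → (ℕ → ℤ) → ℤ
partialSums F m h = sumTo m (λ k → F k h)

partialSums-sub : ∀ {F} → (∀ k (f g : ℕ → ℤ) → F k (λ j → f j - g j) ≡ F k f - F k g) →
  ∀ m (f g : ℕ → ℤ) → partialSums F m (λ j → f j - g j) ≡ partialSums F m f - partialSums F m g
partialSums-sub F-sub m f g = trans (sumTo-cong m (λ k → F-sub k f g)) (sumTo-sub m _ _)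

binomialTransform-mulYMinus1 : ∀ m h →
  binomialTransform m (mulYMinus1 h) ≡ - partialSums binomialTransform m h
binomialTransform-mulYMinus1 zero h = begin
  binomialTransform 0 (mulYMinus1 h)  ≡⟨ binomialTransform-zero (mulYMinus1 h) ⟩
  0ℤ - h 0                            ≡⟨ +-identityˡ (- h 0) ⟩
  - h 0                               ≡⟨ cong -_ (sym (binomialTransform-zero h)) ⟩
  - binomialTransform 0 h             ∎
binomialTransform-mulYMinus1 (suc m) h = begin
  binomialTransform (suc m) (mulYMinus1 h)
    ≡⟨ binomialTransform-suc m (mulYMinus1 h) ⟩
  binomialTransform m (mulYMinus1 h) - binomialTransform m (λ j → h j - h (suc j))
    ≡⟨ cong₂ _-_ (binomialTransform-mulYMinus1 m h)
                 (trans (binomialTransform-sub m h (h ∘ suc)) (sym (binomialTransform-suc m h))) ⟩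
  - partialSums binomialTransform m h - binomialTransform (suc m) h
    ≡⟨ sym (neg-distrib-+ (partialSums binomialTransform m h) _) ⟩
  - partialSums binomialTransform (suc m) h ∎

-- I n p unfolds to diagonalSum n binomialTransform (coeff p).
diagonalSum : ℕ → (ℕ → (ℕ → ℤ) → ℤ) → (ℕ → ℕ → ℤ) → ℤ
diagonalSum n F a = sumTo n (λ i → F (n ∸ i) (a i))

diagonalSum-cong : ∀ n {F} → (∀ m {f g : ℕ → ℤ} → (∀ j → f j ≡ g j) → F m f ≡ F m g) →
  ∀ {a b : ℕ → ℕ → ℤ} → (∀ i j → a i j ≡ b i j) → diagonalSum n F a ≡ diagonalSum n F b
diagonalSum-cong n F-cong a≗b = sumTo-cong n (λ i → F-cong _ (a≗b i))

diagonalSum-suc : ∀ n F a → diagonalSum (suc n) F a ≡ F (suc n) (a 0) + diagonalSum n F (a ∘ suc)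
diagonalSum-suc n F a = sumTo-shift n (λ i → F (suc n ∸ i) (a i))

diagonalSum-partialSums-suc : ∀ F n a →
  diagonalSum (suc n) (partialSums F) a - diagonalSum n (partialSums F) a ≡ diagonalSum (suc n) F a
diagonalSum-partialSums-suc F zero a = cancel (F 0 (a 0)) (F 1 (a 0)) (F 0 (a 1))
  where
  cancel : ∀ x y z → ((x + y) + z) - x ≡ y + z
  cancel = solve-∀
diagonalSum-partialSums-suc F (suc n) a = begin
  diagonalSum (2+ n) S a - diagonalSum (suc n) S a
    ≡⟨ cong₂ _-_ (diagonalSum-suc (suc n) S a) (diagonalSum-suc n S a) ⟩
  ((S (suc n) (a 0) + F (2+ n) (a 0)) + diagonalSum (suc n) S (a ∘ suc))
    - (S (suc n) (a 0) + diagonalSum n S (a ∘ suc))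
    ≡⟨ cancel (S (suc n) (a 0)) _ _ _ ⟩
  F (2+ n) (a 0) + (diagonalSum (suc n) S (a ∘ suc) - diagonalSum n S (a ∘ suc))
    ≡⟨ cong (_+_ (F (2+ n) (a 0))) (diagonalSum-partialSums-suc F n (a ∘ suc)) ⟩
  F (2+ n) (a 0) + diagonalSum (suc n) F (a ∘ suc)
    ≡⟨ sym (diagonalSum-suc (suc n) F a) ⟩
  diagonalSum (2+ n) F a ∎
  where
  S : ℕ → (ℕ → ℤ) → ℤ
  S = partialSums F

  2+ : ℕ → ℕ
  2+ k = suc (suc k)

  cancel : ∀ x y u v → ((x + y) + u) - (x + v) ≡ y + (u - v)
  cancel = solve-∀

diagonalSum-partialSums : ∀ F → (∀ k → F k zeroRow ≡ 0ℤ) → ∀ n a →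
  diagonalSum n (partialSums F) a - diagonalSum n (partialSums F) (shift zeroRow a) ≡
  diagonalSum n F a
diagonalSum-partialSums F F-zero zero a =
  trans (cong (_-_ (F 0 (a 0))) (F-zero 0)) (+-identityʳ (F 0 (a 0)))
diagonalSum-partialSums F F-zero (suc n) a = begin
  diagonalSum (suc n) S a - diagonalSum (suc n) S (shift zeroRow a)
    ≡⟨ cong (_-_ (diagonalSum (suc n) S a)) (diagonalSum-suc n S (shift zeroRow a)) ⟩
  diagonalSum (suc n) S a - (S (suc n) zeroRow + diagonalSum n S a)
    ≡⟨ cong (λ t → diagonalSum (suc n) S a - (t + diagonalSum n S a))
            (sumTo-zero (suc n) F-zero) ⟩
  diagonalSum (suc n) S a - (0ℤ + diagonalSum n S a)
    ≡⟨ cong (_-_ (diagonalSum (suc n) S a)) (+-identityˡ _) ⟩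
  diagonalSum (suc n) S a - diagonalSum n S a
    ≡⟨ diagonalSum-partialSums-suc F n a ⟩
  diagonalSum (suc n) F a ∎
  where
  S : ℕ → (ℕ → ℤ) → ℤ
  S = partialSums F

diagonalSum-mulXYMinus1 : ∀ n a →
  diagonalSum n binomialTransform (λ i → mulYMinus1 (mulXMinus1 a i)) ≡
  diagonalSum n binomialTransform a
diagonalSum-mulXYMinus1 n a = begin
  diagonalSum n binomialTransform (λ i → mulYMinus1 (mulXMinus1 a i))
    ≡⟨ sumTo-cong n (λ i → row (n ∸ i) i) ⟩
  sumTo n (λ i → S (n ∸ i) (a i) - S (n ∸ i) (shift zeroRow a i))
    ≡⟨ sumTo-sub n _ _ ⟩
  diagonalSum n S a - diagonalSum n S (shift zeroRow a)
    ≡⟨ diagonalSum-partialSums binomialTransform binomialTransform-zeroRow n a ⟩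
  diagonalSum n binomialTransform a ∎
  where
  S : ℕ → (ℕ → ℤ) → ℤ
  S = partialSums binomialTransform

  row : ∀ m i → binomialTransform m (mulYMinus1 (mulXMinus1 a i)) ≡
                S m (a i) - S m (shift zeroRow a i)
  row m i = begin
    binomialTransform m (mulYMinus1 (mulXMinus1 a i))
      ≡⟨ binomialTransform-mulYMinus1 m (mulXMinus1 a i) ⟩
    - S m (mulXMinus1 a i)
      ≡⟨ cong -_ (partialSums-sub {binomialTransform} binomialTransform-sub m (shift zeroRow a i) (a i)) ⟩
    - (S m (shift zeroRow a i) - S m (a i))
      ≡⟨ neg-sub (S m (shift zeroRow a i)) (S m (a i)) ⟩
    S m (a i) - S m (shift zeroRow a i) ∎
    where
    neg-sub : ∀ x y → - (x - y) ≡ y - x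
    neg-sub = solve-∀

coeffY-addY : ∀ p q j → coeffY (addY p q) j ≡ coeffY p j + coeffY q j
coeffY-addY []      q       j       = sym (+-identityˡ (coeffY q j))
coeffY-addY (a ∷ p) []      j       = sym (+-identityʳ (coeffY (a ∷ p) j))
coeffY-addY (a ∷ p) (b ∷ q) zero    = refl
coeffY-addY (a ∷ p) (b ∷ q) (suc j) = coeffY-addY p q j

coeffY-scaleY : ∀ c p j → coeffY (scaleY c p) j ≡ c * coeffY p j
coeffY-scaleY c []      j       = sym (*-zeroʳ c)
coeffY-scaleY c (a ∷ p) zero    = refl
coeffY-scaleY c (a ∷ p) (suc j) = coeffY-scaleY c p j

coeffY-∷ : ∀ a p j → coeffY (a ∷ p) j ≡ shift a (coeffY p) j
coeffY-∷ a p zero    = refl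
coeffY-∷ a p (suc j) = refl

coeffY-mulY-∷ : ∀ a p q j →
  coeffY (mulY (a ∷ p) q) j ≡ a * coeffY q j + shift 0ℤ (coeffY (mulY p q)) j
coeffY-mulY-∷ a p q j =
  trans (coeffY-addY (scaleY a q) (0ℤ ∷ mulY p q) j)
        (cong₂ _+_ (coeffY-scaleY a q j) (coeffY-∷ 0ℤ (mulY p q) j))

coeffY-mulY-linear : ∀ a b q j →
  coeffY (mulY (a ∷ b ∷ []) q) j ≡ a * coeffY q j + shift 0ℤ (λ j → b * coeffY q j) j
coeffY-mulY-linear a b q zero    = coeffY-mulY-∷ a (b ∷ []) q 0
coeffY-mulY-linear a b q (suc j) =
  trans (coeffY-mulY-∷ a (b ∷ []) q (suc j))
        (cong (_+_ (a * coeffY q (suc j)))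
              (trans (coeffY-mulY-∷ b [] q j)
                     (trans (cong (_+_ (b * coeffY q j)) (shift-const 0ℤ j))
                            (+-identityʳ (b * coeffY q j)))))

coeff-add2 : ∀ p q i j → coeff (add2 p q) i j ≡ coeff p i j + coeff q i j
coeff-add2 []      q       i       j = sym (+-identityˡ (coeff q i j))
coeff-add2 (r ∷ p) []      i       j = sym (+-identityʳ (coeff (r ∷ p) i j))
coeff-add2 (r ∷ p) (s ∷ q) zero    j = coeffY-addY r s j
coeff-add2 (r ∷ p) (s ∷ q) (suc i) j = coeff-add2 p q i j

coeff-[]∷ : ∀ p i j → coeff ([] ∷ p) i j ≡ shift zeroRow (coeff p) i j
coeff-[]∷ p zero    j = refl
coeff-[]∷ p (suc i) j = refl

coeff-scale2-linear : ∀ a b q i j →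
  coeff (scale2 (a ∷ b ∷ []) q) i j ≡ a * coeff q i j + shift 0ℤ (λ j → b * coeff q i j) j
coeff-scale2-linear a b [] i j = sym (cong₂ _+_ (*-zeroʳ a) (shift-zeros j))
  where
  shift-zeros : ∀ j → shift 0ℤ (λ _ → b * 0ℤ) j ≡ 0ℤ
  shift-zeros zero    = refl
  shift-zeros (suc j) = *-zeroʳ b
coeff-scale2-linear a b (r ∷ q) zero    j = coeffY-mulY-linear a b r j
coeff-scale2-linear a b (r ∷ q) (suc i) j = coeff-scale2-linear a b q i j

coeff-mul2-∷ : ∀ r p q i j →
  coeff (mul2 (r ∷ p) q) i j ≡ coeff (scale2 r q) i j + shift zeroRow (coeff (mul2 p q)) i j
coeff-mul2-∷ r p q i j =
  trans (coeff-add2 (scale2 r q) ([] ∷ mul2 p q) i j)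
        (cong (_+_ (coeff (scale2 r q) i j)) (coeff-[]∷ (mul2 p q) i j))

coeff-mul2-linear : ∀ r s q i j →
  coeff (mul2 (r ∷ s ∷ []) q) i j ≡ coeff (scale2 r q) i j + shift zeroRow (coeff (scale2 s q)) i j
coeff-mul2-linear r s q zero    j = coeff-mul2-∷ r (s ∷ []) q 0 j
coeff-mul2-linear r s q (suc i) j =
  trans (coeff-mul2-∷ r (s ∷ []) q (suc i) j)
        (cong (_+_ (coeff (scale2 r q) (suc i) j))
              (trans (coeff-mul2-∷ s [] q i j)
                     (trans (cong (λ row → coeff (scale2 s q) i j + row j) (shift-const zeroRow i))
                            (+-identityʳ (coeff (scale2 s q) i j)))))

coeff-mulXYMinus1 : ∀ p i j →
  coeff (mul2 (mul2 xMinus1 yMinus1) p) i j ≡ mulYMinus1 (mulXMinus1 (coeff p) i) j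
coeff-mulXYMinus1 p i j =
  trans (coeff-mul2-linear (1ℤ ∷ -1ℤ ∷ []) (-1ℤ ∷ 1ℤ ∷ []) p i j)
        (trans (cong₂ _+_ (coeff-scale2-linear 1ℤ -1ℤ p i j) (shifted i)) (collect i j))
  where
  P : ℕ → ℕ → ℤ
  P = coeff p

  Q : ℕ → ℕ → ℤ
  Q i j = -1ℤ * P i j + shift 0ℤ (λ j → 1ℤ * P i j) j

  shifted : ∀ i → shift zeroRow (coeff (scale2 (-1ℤ ∷ 1ℤ ∷ []) p)) i j ≡ shift zeroRow Q i j
  shifted zero    = refl
  shifted (suc i) = coeff-scale2-linear -1ℤ 1ℤ p i j

  -- The coefficient is a - b - c + d for a = P i j, b = P i (j-1), c = P (i-1) j,
  -- d = P (i-1) (j-1), an entry with a negative index being 0.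
  alternate : ∀ a b c d → (1ℤ * a + -1ℤ * b) + (-1ℤ * c + 1ℤ * d) ≡ (d - b) - (c - a)
  alternate = solve-∀

  collect : ∀ i j → (1ℤ * P i j + shift 0ℤ (λ j → -1ℤ * P i j) j) + shift zeroRow Q i j ≡
                    mulYMinus1 (mulXMinus1 P i) j
  collect zero    zero    = alternate (P 0 0) 0ℤ 0ℤ 0ℤ
  collect zero    (suc j) = alternate (P 0 (suc j)) (P 0 j) 0ℤ 0ℤ
  collect (suc i) zero    = alternate (P (suc i) 0) 0ℤ (P i 0) 0ℤ
  collect (suc i) (suc j) = alternate (P (suc i) (suc j)) (P (suc i) j) (P i (suc j)) (P i j)

I-mulXYMinus1 : ∀ n p → I n (mul2 (mul2 xMinus1 yMinus1) p) ≡ I n p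
I-mulXYMinus1 n p = begin
  I n (mul2 (mul2 xMinus1 yMinus1) p)
    ≡⟨ diagonalSum-cong n binomialTransform-cong (coeff-mulXYMinus1 p) ⟩
  diagonalSum n binomialTransform (λ i → mulYMinus1 (mulXMinus1 (coeff p) i))
    ≡⟨ diagonalSum-mulXYMinus1 n (coeff p) ⟩
  I n p ∎

I-one2 : ∀ n → I n one2 ≡ 1ℤ
I-one2 zero    = refl
I-one2 (suc n) =
  trans (diagonalSum-suc n binomialTransform (coeff one2))
        (cong₂ _+_ (binomialTransform-unit (suc n))
                   (sumTo-zero n (λ i → binomialTransform-zeroRow (n ∸ i))))

lemma3p3 : (n k : ℕ) → I n (pow2 (mul2 xMinus1 yMinus1) k) ≡ 1ℤ
lemma3p3 n zero    = I-one2 n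
lemma3p3 n (suc k) = trans (I-mulXYMinus1 n (pow2 (mul2 xMinus1 yMinus1) k)) (lemma3p3 n k)
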